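{- Let $H$ be the simple undirected graph with vertex set $V(H)=\bigcup_{n\in\mathbb{N}} C_n$, where $\mathbb{N}=\{1,2,3,\dots\}$ and $C_n=\{1,\dots,n\}\times\{n\}$, and edge set $$E(H)=\big\{\{(1,n),(1,n+1)\}: n\in\mathbb{N}\big\}\cup\bigcup_{n\in\mathbb{N}}\{\{x,y\}: x,y\in C_n,\ x\neq y\}.$$ Then the complete graph $K_\omega$ on $\omega$ (countably infinitely many) vertices is not a minor of $H$; that is, there is no family $\{S_k: k\in\omega\}$ of nonempty, pairwise disjoint subsets of $V(H)$, each inducing a connected subgraph of $H$, such that for all $k\neq l$ there exist $s\in S_k$, $t\in S_l$ with $\{s,t\}\in E(H)$.
   Context: For a graph $G$ and a cardinal $\alpha$, $K_\alpha$ is a minor of $G$ iff there is a collection $\{S_\beta:\beta\in\alpha\}$ of nonempty, connected (i.e. inducing a connected subgraph), pairwise disjoint subsets of $V(G)$ such that any two distinct $S_\beta,S_\gamma$ are joined by at least one edge of $G$. -}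

module Defs where

open import Level using (0ℓ)
open import Data.Nat using (ℕ; suc; _≤_)
open import Data.Product using (_×_; _,_; ∃; Σ)
open import Data.Sum using (_⊎_)
open import Relation.Binary.PropositionalEquality using (_≡_; _≢_)
open import Relation.Unary using (Pred)
open import Data.Empty using (⊥)

-- Points of ℕ × ℕ are written (i , n); ℕ here includes 0 but the
-- vertex set of H only uses i, n ≥ 1.
Pt : Set
Pt = ℕ × ℕ

IsVertex : Pt → Set
IsVertex (i , n) = (1 ≤ i) × (i ≤ n)

Adj : Pt → Pt → Set
Adj (i , n) (j , m) =
    (IsVertex (i , n) × IsVertex (j , m) × n ≡ m × i ≢ j)
  ⊎ (i ≡ 1 × j ≡ 1 × 1 ≤ n × 1 ≤ m × (m ≡ suc n ⊎ n ≡ suc m))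

data WalkIn (S : Pred Pt 0ℓ) : Pt → Pt → Set where
  here : ∀ {u} → WalkIn S u u
  step : ∀ {u w v} → Adj u w → S w → WalkIn S w v → WalkIn S u v

InducesConnected : Pred Pt 0ℓ → Set
InducesConnected S = ∀ u v → S u → S v → WalkIn S u v

IsKωMinorModel : (ℕ → Pred Pt 0ℓ) → Set
IsKωMinorModel S =
    (∀ k x → S k x → IsVertex x)
  × (∀ k → ∃ λ x → S k x)
  × (∀ k → InducesConnected (S k))
  × (∀ k l x → k ≢ l → S k x → S l x → ⊥)
  × (∀ k l → k ≢ l → ∃ λ s → ∃ λ t → S k s × S l t × Adj s t)

KωMinorOfH : Set₁
KωMinorOfH = Σ (ℕ → Pred Pt 0ℓ) IsKωMinorModel

module Submission where

-- Call n the level of the vertex (i , n).  Every edge of H either joins two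
-- vertices of the same level or is a column-one edge (1 , n) — (1 , n + 1).
-- Hence the only edge crossing the cut between levels ≤ t and levels > t is
-- (1 , t) — (1 , t + 1), so every connected set that meets both sides of the
-- cut contains the gate vertex (1 , t + 1) (lemma gate).  If a connected set
-- A meeting levels ≤ t is joined by an edge to a connected set B meeting
-- levels > t, then A ∪ B is connected and meets both sides, so one of A, B
-- contains (1 , t + 1) (lemma bottleneck).
--
-- Given a model (S k)ₖ, pick a vertex base k in each S k.  The bases are
-- pairwise distinct and there are only finitely many vertices below any
-- level, so bases of arbitrarily high level occur arbitrarily late (lemma
-- unbounded-levels).  With T the larger level of base 0 and base 1, choose
-- distinct c₁, c₂ ≥ 2 whose bases lie above T.  Then (1 , T + 1) lies in
-- S 0 ∪ S c₁ and in S 1 ∪ S c₂, hence in two of four disjoint sets.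

open import Defs
open import Level using (0ℓ)
open import Data.Nat using (ℕ; suc; _+_; _*_; _≤_; _<_; _⊔_; _≤?_; _<?_; z≤n; s≤s; s≤s⁻¹)
open import Data.Nat.Properties
  using (≤-refl; ≤-antisym; ≤-trans; <-trans; <-asym; <⇒≱; <⇒≢; ≰⇒>; ≮⇒≥; m≤m+n; m≤m⊔n; m≤n⊔m; +-cancelˡ-≡)
open import Data.Fin using (Fin; toℕ; fromℕ<; combine) renaming (_<_ to _<ᶠ_)
open import Data.Fin.Properties using (pigeonhole; any?; combine-injective; fromℕ<-injective)
open import Data.Product using (_×_; _,_; proj₁; proj₂; ∃; ∃₂)
open import Data.Sum using (_⊎_; inj₁; inj₂)
open import Data.Empty using (⊥; ⊥-elim)
open import Function using (_∘_)
open import Relation.Nullary using (¬_; yes; no)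
open import Relation.Unary using (Pred; _⊆_; _∪_)
open import Relation.Binary.PropositionalEquality using (_≡_; _≢_; refl; sym; cong; cong₂; subst)

level : Pt → ℕ
level = proj₂

Separated : ℕ → ℕ → ℕ → Set
Separated t a b = (a ≤ t × t < b) ⊎ (b ≤ t × t < a)

not-self-separated : ∀ {t a} → ¬ Separated t a a
not-self-separated (inj₁ (a≤t , t<a)) = <⇒≱ t<a a≤t
not-self-separated (inj₂ (a≤t , t<a)) = <⇒≱ t<a a≤t

separated-split : ∀ t a b c → Separated t a c → Separated t a b ⊎ Separated t b c
separated-split t a b c sep with b ≤? t
separated-split t a b c (inj₁ (a≤t , t<c)) | yes b≤t = inj₂ (inj₁ (b≤t , t<c))
separated-split t a b c (inj₂ (c≤t , t<a)) | yes b≤t = inj₁ (inj₂ (b≤t , t<a))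
separated-split t a b c (inj₁ (a≤t , t<c)) | no b≰t  = inj₁ (inj₁ (a≤t , ≰⇒> b≰t))
separated-split t a b c (inj₂ (c≤t , t<a)) | no b≰t  = inj₂ (inj₂ (c≤t , ≰⇒> b≰t))

-- An edge of H crossing the cut between t and t + 1 has (1 , t + 1) as an
-- end: same-level edges never cross, and a column-one edge
-- (1 , n) — (1 , n + 1) crosses it only when n = t.
crossing-edge : ∀ {t u w} → Adj u w → Separated t (level u) (level w) →
                u ≡ (1 , suc t) ⊎ w ≡ (1 , suc t)
crossing-edge (inj₁ (_ , _ , refl , _)) sep = ⊥-elim (not-self-separated sep)
crossing-edge (inj₂ (refl , refl , _ , _ , inj₁ refl)) (inj₁ (n≤t , t<1+n)) =
  inj₂ (cong (λ n → 1 , suc n) (≤-antisym n≤t (s≤s⁻¹ t<1+n)))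
crossing-edge (inj₂ (refl , refl , _ , _ , inj₁ refl)) (inj₂ (n<t , t<n)) =
  ⊥-elim (<-asym n<t t<n)
crossing-edge (inj₂ (refl , refl , _ , _ , inj₂ refl)) (inj₁ (m<t , t<m)) =
  ⊥-elim (<-asym m<t t<m)
crossing-edge (inj₂ (refl , refl , _ , _ , inj₂ refl)) (inj₂ (m≤t , t<1+m)) =
  inj₁ (cong (λ m → 1 , suc m) (≤-antisym m≤t (s≤s⁻¹ t<1+m)))

gate : ∀ {C : Pred Pt 0ℓ} {t u v} → C u → WalkIn C u v →
       Separated t (level u) (level v) → C (1 , suc t)
gate Cu here sep = ⊥-elim (not-self-separated sep)
gate {C} {t} {u} {v} Cu (step {w = w} u~w Cw walk) sep
  with separated-split t (level u) (level w) (level v) sep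
... | inj₂ sep-wv = gate Cw walk sep-wv
... | inj₁ sep-uw with crossing-edge u~w sep-uw
...   | inj₁ u≡gate = subst C u≡gate Cu
...   | inj₂ w≡gate = subst C w≡gate Cw

walk-mono : ∀ {C D : Pred Pt 0ℓ} → C ⊆ D → ∀ {u v} → WalkIn C u v → WalkIn D u v
walk-mono C⊆D here              = here
walk-mono C⊆D (step u~w Cw walk) = step u~w (C⊆D Cw) (walk-mono C⊆D walk)

walk-++ : ∀ {C : Pred Pt 0ℓ} {u v x} → WalkIn C u v → WalkIn C v x → WalkIn C u x
walk-++ here               rest = rest
walk-++ (step u~w Cw walk) rest = step u~w Cw (walk-++ walk rest)

bottleneck : ∀ {A B : Pred Pt 0ℓ} {t a b s u} →
             InducesConnected A → InducesConnected B →
             A a → B b → A s → B u → Adj s u →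
             level a ≤ t → t < level b → (A ∪ B) (1 , suc t)
bottleneck {A} {B} {a = a} {b} connA connB Aa Bb As Bu s~u a≤t t<b =
  gate (inj₁ Aa) walk (inj₁ (a≤t , t<b))
  where
  walk : WalkIn (A ∪ B) a b
  walk = walk-++ (walk-mono inj₁ (connA _ _ Aa As))
                 (step s~u (inj₂ Bu) (walk-mono inj₂ (connB _ _ Bu Bb)))

InBox : ℕ → Pt → Set
InBox L (i , n) = i ≤ L × n ≤ L

-- Coding the box injectively by Fin ((L + 1)²), so that pigeonhole applies.
box-code : ∀ L p → InBox L p → Fin (suc L * suc L)
box-code L (i , n) (i≤L , n≤L) = combine (fromℕ< (s≤s i≤L)) (fromℕ< (s≤s n≤L))

box-code-injective : ∀ L p q (p∈ : InBox L p) (q∈ : InBox L q) →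
                     box-code L p p∈ ≡ box-code L q q∈ → p ≡ q
box-code-injective L (i , n) (j , m) (i≤L , n≤L) (j≤L , m≤L) same
  with combine-injective _ _ _ _ same
... | i≡j , n≡m = cong₂ _,_ (fromℕ<-injective i j (s≤s i≤L) (s≤s j≤L) i≡j)
                            (fromℕ<-injective n m (s≤s n≤L) (s≤s m≤L) n≡m)

box-pigeonhole : ∀ L (f : Fin (suc (suc L * suc L)) → Pt) → (f∈ : ∀ i → InBox L (f i)) →
                 ∃₂ λ i j → i <ᶠ j × f i ≡ f j
box-pigeonhole L f f∈ with pigeonhole (s≤s ≤-refl) (λ i → box-code L (f i) (f∈ i))
... | i , j , i<j , same = i , j , i<j , box-code-injective L _ _ (f∈ i) (f∈ j) same

-- A sequence of pairwise distinct vertices of H reaches above every level L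
-- at some index ≥ o: otherwise the (L + 1)² + 1 vertices at indices
-- o, o + 1, … would all lie in the box of size L.
unbounded-levels : (f : ℕ → Pt) → (∀ k → IsVertex (f k)) →
                   (∀ k l → k ≢ l → f k ≢ f l) →
                   ∀ L o → ∃ λ k → o ≤ k × L < level (f k)
unbounded-levels f vertex distinct L o with any? (λ i → L <? level (f (o + toℕ i)))
... | yes (i , high) = o + toℕ i , m≤m+n o (toℕ i) , high
... | no none = ⊥-elim (repeat (box-pigeonhole L g g∈))
  where
  g : Fin (suc (suc L * suc L)) → Pt
  g i = f (o + toℕ i)
  g∈ : ∀ i → InBox L (g i)
  g∈ i = ≤-trans (proj₂ (vertex (o + toℕ i))) low , low
    where
    low : level (g i) ≤ L
    low = ≮⇒≥ (λ high → none (i , high))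
  repeat : (∃₂ λ i j → i <ᶠ j × g i ≡ g j) → ⊥
  repeat (i , j , i<j , same) = distinct _ _ (<⇒≢ i<j ∘ +-cancelˡ-≡ o _ _) same

parts-cover-gate : ∀ {S} → IsKωMinorModel S → ∀ {k c a b t} → k ≢ c →
                   S k a → S c b → level a ≤ t → t < level b → (S k ∪ S c) (1 , suc t)
parts-cover-gate (_ , _ , connected , _ , joined) {k} {c} k≢c Sa Sb a≤t t<b
  with joined k c k≢c
... | s , u , Ss , Su , s~u = bottleneck (connected k) (connected c) Sa Sb Ss Su s~u a≤t t<b

no-double-cover : ∀ (S : ℕ → Pred Pt 0ℓ) → (∀ k l x → k ≢ l → S k x → S l x → ⊥) →
                  ∀ {a b c d x} → a < b → b < c → c < d →
                  (S a ∪ S c) x → (S b ∪ S d) x → ⊥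
no-double-cover S disjoint {a} {b} {c} {d} {x} a<b b<c c<d = cover
  where
  cover : (S a ∪ S c) x → (S b ∪ S d) x → ⊥
  cover (inj₁ Sa) (inj₁ Sb) = disjoint a b x (<⇒≢ a<b) Sa Sb
  cover (inj₁ Sa) (inj₂ Sd) = disjoint a d x (<⇒≢ (<-trans a<b (<-trans b<c c<d))) Sa Sd
  cover (inj₂ Sc) (inj₁ Sb) = disjoint b c x (<⇒≢ b<c) Sb Sc
  cover (inj₂ Sc) (inj₂ Sd) = disjoint c d x (<⇒≢ c<d) Sc Sd

-- In a model, parts reaching above any level L occur at arbitrarily late
-- indices: choose a vertex in each part; disjointness makes these choices
-- pairwise distinct, so unbounded-levels applies.
high-parts : ∀ {S} → IsKωMinorModel S → ∀ L o →
             ∃ λ k → o ≤ k × ∃ λ x → S k x × L < level x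
high-parts {S} (isVertex , nonempty , _ , disjoint , _) L o =
  witness (unbounded-levels base (λ k → isVertex k _ (base∈ k)) bases-distinct L o)
  where
  base : ℕ → Pt
  base k = proj₁ (nonempty k)
  base∈ : ∀ k → S k (base k)
  base∈ k = proj₂ (nonempty k)
  bases-distinct : ∀ k l → k ≢ l → base k ≢ base l
  bases-distinct k l k≢l same =
    disjoint k l (base k) k≢l (base∈ k) (subst (S l) (sym same) (base∈ l))
  witness : (∃ λ k → o ≤ k × L < level (base k)) →
            ∃ λ k → o ≤ k × ∃ λ x → S k x × L < level x
  witness (k , o≤k , above) = k , o≤k , base k , base∈ k , above

mainTheorem2 : ¬ KωMinorOfH
mainTheorem2 (S , model@(_ , nonempty , _ , disjoint , _))
  with nonempty 0 | nonempty 1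
... | a₀ , S₀a₀ | a₁ , S₁a₁
  with high-parts model (level a₀ ⊔ level a₁) 2
... | c₁ , 1<c₁ , b₁ , Sc₁b₁ , above₁
  with high-parts model (level a₀ ⊔ level a₁) (suc c₁)
... | c₂ , c₁<c₂ , b₂ , Sc₂b₂ , above₂ =
  no-double-cover S disjoint 0<1 1<c₁ c₁<c₂
    (parts-cover-gate model (<⇒≢ (<-trans 0<1 1<c₁)) S₀a₀ Sc₁b₁ (m≤m⊔n _ _) above₁)
    (parts-cover-gate model (<⇒≢ (<-trans 1<c₁ c₁<c₂)) S₁a₁ Sc₂b₂ (m≤n⊔m _ _) above₂)
  where
  0<1 : 0 < 1
  0<1 = s≤s z≤n
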